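{- Let $s\ge 1$ and $L\ge 3$ be integers. There exists an integer $M_{L,s}$, depending on $L$ and $s$, such that for every integer $k$ with $\max\{s+1,L\}\le k\le s+L$ and every integer $n\ge M_{L,s}$, \[ f_{L,s,k}(n)\ge c_{L,s,2}(n). \]
   Context: For positive integers $L,s,n$: $c_{L,s,2}(n)$ denotes the number of partitions of $n$ all of whose parts lie in $\{s+1,\ldots,s+L\}$. For positive integers $L,s,k,n$: $f_{L,s,k}(n)$ denotes the number of partitions of $n$ whose smallest part equals $s$, whose largest part is at most $L+s$, and which have no part equal to $k$. -}

module Defs where

open import Data.Nat using (ℕ; zero; suc; _+_; _∸_; _≤_; _<_; _≟_; _≤?_; _⊔_)
open import Data.Nat.Properties using (_≟_)
open import Data.List using (List; []; _∷_; length; filter; map; concatMap; upTo)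
open import Data.List.Relation.Unary.All using (All)
open import Data.List.Relation.Unary.All as All using ()
open import Data.List.Relation.Unary.Any using (Any)
open import Data.Bool using (Bool; true; false; _∧_; not)
open import Relation.Nullary.Decidable using (⌊_⌋)

-- A partition is represented as a weakly decreasing list of positive parts.
-- partsAtMost m n : all partitions of n into parts each ≤ m (listed with
-- largest part first, weakly decreasing).
partsAtMostF : ℕ → ℕ → ℕ → List (List ℕ)
partsAtMostF fuel     m zero = [] ∷ []
partsAtMostF zero     m (suc n) = []
partsAtMostF (suc fuel) m (suc n) =
  concatMap (λ p → map (p ∷_) (partsAtMostF fuel p (suc n ∸ p)))
            (filter (λ p → p ≤? suc n) (map suc (upTo m)))

partitions : ℕ → List (List ℕ)
partitions n = partsAtMostF n n n

allB : (ℕ → Bool) → List ℕ → Bool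
allB P []       = true
allB P (x ∷ xs) = P x ∧ allB P xs

anyB : (ℕ → Bool) → List ℕ → Bool
anyB P []       = false
anyB P (x ∷ xs) = P x Data.Bool.∨ anyB P xs

-- smallest part of a partition (0 for the empty partition)
smallestPart : List ℕ → ℕ
smallestPart []           = 0
smallestPart (x ∷ [])     = x
smallestPart (x ∷ y ∷ ys) = smallestPart (y ∷ ys)

count : (List ℕ → Bool) → ℕ → ℕ
count P n = length (filter (λ π → Data.Bool._≟_ (P π) true) (partitions n))

c2 : ℕ → ℕ → ℕ → ℕ
c2 L s n = count (allB (λ x → ⌊ suc s ≤? x ⌋ ∧ ⌊ x ≤? s + L ⌋)) n

f : ℕ → ℕ → ℕ → ℕ → ℕ
f L s k n = count (λ π → ⌊ smallestPart π ≟ s ⌋ ∧ not (anyB (λ x → ⌊ x ≟ k ⌋) π)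
                         ∧ allB (λ x → ⌊ x ≤? L + s ⌋) π) n

-- Let a partition of n into parts from (s, s + L] contain m copies of k. Its image drops those
-- copies and rebuilds their weight from allowed parts of a fixed gadget together with copies
-- of s, at least one of which is always needed. When m is large the weight m·k alone suffices
-- ("bulk"); when m is bounded, some part j ≠ k occurs very often as soon as n is large, and a
-- fixed number of copies of j is given up as well ("borrow"). The number of copies of s written
-- in base k and in mixed radix records the case, m and j, so the partition can be recovered from
-- its multiplicities in the image: the map is an injection into the partitions counted by f.

module Submission where

open import Defs
open import Data.Bool using (Bool; true; false; _∧_; not)
open import Data.Bool.Properties using (∧-conicalˡ; ∧-conicalʳ)
import Data.Bool as Bool
open import Data.Empty using (⊥; ⊥-elim)
open import Data.List using (List; []; _∷_; _++_; length; filter; map; replicate; upTo)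
open import Data.List.Membership.Propositional using (_∈_; find)
open import Data.List.Membership.Propositional.Properties
open import Data.List.Properties using (length-++; length-map; ∷-injective)
open import Data.List.Relation.Binary.Subset.Propositional using (_⊆_)
open import Data.List.Relation.Unary.All as All using (All; []; _∷_)
import Data.List.Relation.Unary.All.Properties as All
open import Data.List.Relation.Unary.AllPairs as AllPairs using ([]; _∷_)
import Data.List.Relation.Unary.AllPairs.Properties as AllPairs
open import Data.List.Relation.Unary.Any as Any using (here; there)
open import Data.List.Relation.Unary.Unique.Propositional using (Unique)
import Data.List.Relation.Unary.Unique.Propositional.Properties as Unique
open import Data.Nat
open import Data.Nat.DivMod
open import Data.Nat.ListAction using (sum)
open import Data.Nat.ListAction.Properties using (sum-++)
open import Data.Nat.Properties
open import Algebra.Properties.CommutativeSemigroup +-commutativeSemigroup using (interchange; xy∙z≈xz∙y)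
open import Algebra.Properties.CommutativeSemigroup *-commutativeSemigroup using (x∙yz≈y∙xz)
open import Data.Nat.Tactic.RingSolver using (solve-∀)
open import Data.Product using (∃; _×_; _,_; proj₁; proj₂)
open import Data.Sum using (_⊎_; inj₁; inj₂)
open import Data.Unit using (⊤; tt)
open import Function using (_∘_)
open import Relation.Binary.PropositionalEquality
open import Relation.Nullary using (¬_; Dec; yes; no; ¬?; _×-dec_)
open import Relation.Nullary.Decidable using (⌊_⌋)

-- Enumeration of partitions

Descending : ℕ → List ℕ → Set
Descending m []       = ⊤
Descending m (x ∷ xs) = x ≤ m × Descending x xs

Descending-weaken : ∀ {m m′} xs → m ≤ m′ → Descending m xs → Descending m′ xs
Descending-weaken []       _    _          = tt
Descending-weaken (x ∷ xs) m≤m′ (x≤m , ds) = ≤-trans x≤m m≤m′ , ds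

Descending-head≤sum : ∀ {m} xs → Descending m xs → Descending (sum xs) xs
Descending-head≤sum []       _        = tt
Descending-head≤sum (x ∷ xs) (_ , ds) = m≤m+n x (sum xs) , ds

Descending-bound : ∀ {m} xs → Descending m xs → ∀ {x} → x ∈ xs → x ≤ m
Descending-bound (y ∷ xs) (y≤m , ds) (here refl) = y≤m
Descending-bound (y ∷ xs) (y≤m , ds) (there x∈) = ≤-trans (Descending-bound xs ds x∈) y≤m

private
  heads : ℕ → ℕ → List ℕ
  heads m n = filter (λ p → p ≤? suc n) (map suc (upTo m))

  tails : ℕ → ℕ → ℕ → List (List ℕ)
  tails fuel n p = map (p ∷_) (partsAtMostF fuel p (suc n ∸ p))

partsAtMostF-sound : ∀ fuel m n π → π ∈ partsAtMostF fuel m n →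
                     Descending m π × All (0 <_) π × sum π ≡ n
partsAtMostF-sound fuel m zero .[] (here refl) = tt , [] , refl
partsAtMostF-sound (suc fuel) m (suc n) π π∈
  with find (∈-concatMap⁻ (tails fuel n) {xs = heads m n} π∈)
... | p , p∈ , π∈′ with ∈-map⁻ (p ∷_) π∈′
... | π′ , π′∈ , refl with ∈-filter⁻ (λ p → p ≤? suc n) {xs = map suc (upTo m)} p∈
... | p∈m , p≤ with ∈-map⁻ suc p∈m
... | i , i∈ , refl with partsAtMostF-sound fuel (suc i) (suc n ∸ suc i) π′ π′∈
... | ds , pos , sum≡ =
  (∈-upTo⁻ i∈ , ds) , s≤s z≤n ∷ pos , trans (cong (suc i +_) sum≡) (m+[n∸m]≡n p≤)

partsAtMostF-complete : ∀ fuel m π → Descending m π → All (0 <_) π → sum π ≤ fuel →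
                        π ∈ partsAtMostF fuel m (sum π)
partsAtMostF-complete fuel m [] _ _ _ = here refl
partsAtMostF-complete (suc fuel) m (suc p ∷ π) (p<m , ds) (_ ∷ pos) (s≤s π≤fuel) =
  ∈-concatMap⁺ (tails fuel (p + sum π)) {xs = heads m (p + sum π)}
    (Any.map (λ { refl → ∈-map⁺ (suc p ∷_) tail∈ }) head∈)
  where
  head∈ : suc p ∈ heads m (p + sum π)
  head∈ = ∈-filter⁺ (λ q → q ≤? suc (p + sum π)) (∈-map⁺ suc (∈-upTo⁺ p<m)) (s≤s (m≤m+n p (sum π)))
  tail∈ : π ∈ partsAtMostF fuel (suc p) (suc (p + sum π) ∸ suc p)
  tail∈ = subst (λ n → π ∈ partsAtMostF fuel (suc p) n) (sym (m+n∸m≡n p (sum π)))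
            (partsAtMostF-complete fuel (suc p) π ds pos (≤-trans (m≤n+m (sum π) p) π≤fuel))

partsAtMostF-unique : ∀ fuel m n → Unique (partsAtMostF fuel m n)
partsAtMostF-unique fuel       m zero    = [] ∷ []
partsAtMostF-unique zero       m (suc n) = []
partsAtMostF-unique (suc fuel) m (suc n) =
  Unique.concat⁺ (All.map⁺ (All.tabulate λ {p} _ → tails-unique p))
                 (AllPairs.map⁺ (AllPairs.map tails-disjoint heads-unique))
  where
  heads-unique : Unique (heads m n)
  heads-unique = Unique.filter⁺ (λ p → p ≤? suc n) (Unique.map⁺ suc-injective (Unique.upTo⁺ m))
  tails-unique : ∀ p → Unique (tails fuel n p)
  tails-unique p = Unique.map⁺ (λ { refl → refl }) (partsAtMostF-unique fuel p (suc n ∸ p))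
  tails-disjoint : ∀ {p q} → p ≢ q → ∀ {π} → π ∈ tails fuel n p × π ∈ tails fuel n q → ⊥
  tails-disjoint p≢q (π∈p , π∈q) with ∈-map⁻ _ π∈p | ∈-map⁻ _ π∈q
  ... | _ , _ , refl | _ , _ , eq = p≢q (proj₁ (∷-injective eq))

partitions-sound : ∀ {n π} → π ∈ partitions n → Descending n π × All (0 <_) π × sum π ≡ n
partitions-sound {n} = partsAtMostF-sound n n n _

partitions-complete : ∀ {n π} → Descending n π → All (0 <_) π → sum π ≡ n → π ∈ partitions n
partitions-complete {π = π} ds pos refl = partsAtMostF-complete (sum π) (sum π) π ds pos ≤-refl

-- Counting by an injection

Unique-⊆⇒length-≤ : ∀ {A : Set} {xs ys : List A} → Unique xs → xs ⊆ ys → length xs ≤ length ys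
Unique-⊆⇒length-≤ {xs = []} _ _ = z≤n
Unique-⊆⇒length-≤ {xs = x ∷ xs} (x∉xs ∷ u) xxs⊆ys with ∈-∃++ (xxs⊆ys (here refl))
... | ys₁ , ys₂ , refl = begin
  suc (length xs)               ≤⟨ s≤s (Unique-⊆⇒length-≤ u xs⊆ys₁ys₂) ⟩
  suc (length (ys₁ ++ ys₂))     ≡⟨ cong suc (length-++ ys₁) ⟩
  suc (length ys₁ + length ys₂) ≡⟨ sym (+-suc (length ys₁) (length ys₂)) ⟩
  length ys₁ + length (x ∷ ys₂) ≡⟨ sym (length-++ ys₁) ⟩
  length (ys₁ ++ x ∷ ys₂)       ∎
  where
  open ≤-Reasoning
  ∈-delete : ∀ {y} zs → y ∈ zs ++ x ∷ ys₂ → y ≢ x → y ∈ zs ++ ys₂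
  ∈-delete []       (here y≡x)  y≢x = ⊥-elim (y≢x y≡x)
  ∈-delete []       (there y∈)  _   = y∈
  ∈-delete (z ∷ zs) (here y≡z)  _   = here y≡z
  ∈-delete (z ∷ zs) (there y∈)  y≢x = there (∈-delete zs y∈ y≢x)
  xs⊆ys₁ys₂ : xs ⊆ ys₁ ++ ys₂
  xs⊆ys₁ys₂ y∈ = ∈-delete ys₁ (xxs⊆ys (there y∈)) (λ { refl → All.lookup x∉xs y∈ refl })

Unique-map : ∀ {A B : Set} (h : A → B) {xs} → Unique xs →
             (∀ {a b} → a ∈ xs → b ∈ xs → h a ≡ h b → a ≡ b) → Unique (map h xs)
Unique-map h {[]}     _          _   = []
Unique-map h {x ∷ xs} (x∉xs ∷ u) inj =
  All.tabulate hx≢ ∷ Unique-map h u (λ a∈ b∈ → inj (there a∈) (there b∈))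
  where
  hx≢ : ∀ {z} → z ∈ map h xs → h x ≢ z
  hx≢ z∈ refl with ∈-map⁻ h z∈
  ... | w , w∈ , hx≡hw = All.lookup x∉xs w∈ (inj (here refl) (there w∈) hx≡hw)

count-mono-injection : ∀ (P Q : List ℕ → Bool) n (h : List ℕ → List ℕ) →
  (∀ {π} → π ∈ partitions n → P π ≡ true → h π ∈ partitions n × Q (h π) ≡ true) →
  (∀ {π π′} → π ∈ partitions n → P π ≡ true → π′ ∈ partitions n → P π′ ≡ true →
     h π ≡ h π′ → π ≡ π′) →
  count P n ≤ count Q n
count-mono-injection P Q n h maps-to injective =
  subst (_≤ length Qs) (length-map h Ps)
    (Unique-⊆⇒length-≤ (Unique-map h Ps-unique injectiveOn) hPs⊆Qs)
  where
  Ps = filter (λ π → P π Bool.≟ true) (partitions n)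
  Qs = filter (λ π → Q π Bool.≟ true) (partitions n)
  ∈Ps : ∀ {π} → π ∈ Ps → π ∈ partitions n × P π ≡ true
  ∈Ps = ∈-filter⁻ (λ π → P π Bool.≟ true)
  Ps-unique : Unique Ps
  Ps-unique = Unique.filter⁺ (λ π → P π Bool.≟ true) (partsAtMostF-unique n n n)
  injectiveOn : ∀ {π π′} → π ∈ Ps → π′ ∈ Ps → h π ≡ h π′ → π ≡ π′
  injectiveOn π∈ π′∈ = let (a , b) = ∈Ps π∈ ; (c , d) = ∈Ps π′∈ in injective a b c d
  hPs⊆Qs : map h Ps ⊆ Qs
  hPs⊆Qs z∈ with ∈-map⁻ h z∈
  ... | π , π∈ , refl =
    let (a , b) = ∈Ps π∈ ; (c , d) = maps-to a b in ∈-filter⁺ (λ π → Q π Bool.≟ true) c d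

-- Multiplicities

δ : ℕ → ℕ → ℕ
δ v x with v ≟ x
... | yes _ = 1
... | no  _ = 0

δ-refl : ∀ v → δ v v ≡ 1
δ-refl v with v ≟ v
... | yes _   = refl
... | no  v≢v = ⊥-elim (v≢v refl)

δ-≢ : ∀ {v x} → v ≢ x → δ v x ≡ 0
δ-≢ {v} {x} v≢x with v ≟ x
... | yes v≡x = ⊥-elim (v≢x v≡x)
... | no  _   = refl

multiplicity : ℕ → List ℕ → ℕ
multiplicity v []       = 0
multiplicity v (x ∷ xs) = δ v x + multiplicity v xs

multiplicity>0⇒∈ : ∀ v xs → 0 < multiplicity v xs → v ∈ xs
multiplicity>0⇒∈ v (x ∷ xs) pos with v ≟ x
... | yes refl = here refl
... | no  _    = there (multiplicity>0⇒∈ v xs pos)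

∉⇒multiplicity≡0 : ∀ v xs → ¬ v ∈ xs → multiplicity v xs ≡ 0
∉⇒multiplicity≡0 v []       _   = refl
∉⇒multiplicity≡0 v (x ∷ xs) v∉ with v ≟ x
... | yes v≡x = ⊥-elim (v∉ (here v≡x))
... | no  _   = ∉⇒multiplicity≡0 v xs (v∉ ∘ there)

multiplicity-++ : ∀ v xs ys → multiplicity v (xs ++ ys) ≡ multiplicity v xs + multiplicity v ys
multiplicity-++ v []       ys = refl
multiplicity-++ v (x ∷ xs) ys =
  trans (cong (δ v x +_) (multiplicity-++ v xs ys)) (sym (+-assoc (δ v x) _ _))

multiplicity-replicate : ∀ v c t → multiplicity v (replicate c t) ≡ c * δ v t
multiplicity-replicate v zero    t = refl
multiplicity-replicate v (suc c) t = cong (δ v t +_) (multiplicity-replicate v c t)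

Descending-≡ : ∀ {m m′} xs ys → Descending m xs → Descending m′ ys →
               (∀ v → multiplicity v xs ≡ multiplicity v ys) → xs ≡ ys
Descending-≡ []       []       _ _ _ = refl
Descending-≡ []       (y ∷ ys) _ _ eq = ⊥-elim (0≢1+n (trans (eq y) (cong (_+ multiplicity y ys) (δ-refl y))))
Descending-≡ (x ∷ xs) []       _ _ eq = ⊥-elim (0≢1+n (trans (sym (eq x)) (cong (_+ multiplicity x xs) (δ-refl x))))
Descending-≡ (x ∷ xs) (y ∷ ys) (_ , dxs) (_ , dys) eq =
  cong₂ _∷_ x≡y (Descending-≡ xs ys dxs dys eq′)
  where
  occurs : ∀ v zs → 0 < multiplicity v (v ∷ zs)
  occurs v zs = subst (λ d → 0 < d + multiplicity v zs) (sym (δ-refl v)) (s≤s z≤n)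
  -- each head is the largest entry of the other list
  x≡y : x ≡ y
  x≡y = ≤-antisym
    (Descending-bound (y ∷ ys) (≤-refl , dys) (multiplicity>0⇒∈ x _ (subst (0 <_) (eq x) (occurs x xs))))
    (Descending-bound (x ∷ xs) (≤-refl , dxs) (multiplicity>0⇒∈ y _ (subst (0 <_) (sym (eq y)) (occurs y ys))))
  eq′ : ∀ v → multiplicity v xs ≡ multiplicity v ys
  eq′ v = +-cancelˡ-≡ (δ v x) _ _ (trans (eq v) (cong (λ z → δ v z + multiplicity v ys) (sym x≡y)))

-- Partitions with parts in a window, given by their multiplicities

InWindow : ℕ → ℕ → ℕ → Set
InWindow lo len v = lo ≤ v × v < lo + len

InWindow? : ∀ lo len v → Dec (InWindow lo len v)
InWindow? lo len v = (lo ≤? v) ×-dec (v <? lo + len)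

module _ {lo len : ℕ} where

  InWindow-lo : InWindow lo (suc len) lo
  InWindow-lo = ≤-refl , m<m+n lo (s≤s z≤n)

  InWindow-step : ∀ {v} → InWindow (suc lo) len v → InWindow lo (suc len) v
  InWindow-step {v} (lo<v , v<) = <⇒≤ lo<v , subst (v <_) (sym (+-suc lo len)) v<

  InWindow-above : ∀ {v} → InWindow lo (suc len) v → v ≢ lo → InWindow (suc lo) len v
  InWindow-above {v} (lo≤v , v<) v≢lo =
    ≤∧≢⇒< lo≤v (v≢lo ∘ sym) , subst (v <_) (+-suc lo len) v<

  lo∉InWindow-suc : ¬ InWindow (suc lo) len lo
  lo∉InWindow-suc (lo<lo , _) = <-irrefl refl lo<lo

InWindow-empty : ∀ {lo v} → ¬ InWindow lo 0 v
InWindow-empty {lo} (lo≤v , v<lo+0) = <-irrefl refl (≤-trans v<lo+0 (≤-trans (≤-reflexive (+-identityʳ lo)) lo≤v))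

weight : (ℕ → ℕ) → ℕ → ℕ → ℕ
weight y lo zero      = 0
weight y lo (suc len) = lo * y lo + weight y (suc lo) len

expand : (ℕ → ℕ) → ℕ → ℕ → List ℕ
expand y lo zero      = []
expand y lo (suc len) = expand y (suc lo) len ++ replicate (y lo) lo

module _ where
  private
    variable
      y z : ℕ → ℕ

  weight-cong : ∀ lo len → (∀ v → InWindow lo len v → y v ≡ z v) → weight y lo len ≡ weight z lo len
  weight-cong lo zero      _  = refl
  weight-cong lo (suc len) eq =
    cong₂ _+_ (cong (lo *_) (eq lo InWindow-lo)) (weight-cong (suc lo) len (λ v → eq v ∘ InWindow-step))

  weight-mono : ∀ lo len → (∀ v → InWindow lo len v → y v ≤ z v) → weight y lo len ≤ weight z lo len
  weight-mono lo zero      _  = z≤n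
  weight-mono lo (suc len) le =
    +-mono-≤ (*-monoʳ-≤ lo (le lo InWindow-lo)) (weight-mono (suc lo) len (λ v → le v ∘ InWindow-step))

  weight-zero : ∀ lo len → (∀ v → InWindow lo len v → y v ≡ 0) → weight y lo len ≡ 0
  weight-zero lo zero      _      = refl
  weight-zero lo (suc len) vanish =
    cong₂ _+_ (trans (cong (lo *_) (vanish lo InWindow-lo)) (*-zeroʳ lo))
              (weight-zero (suc lo) len (λ v → vanish v ∘ InWindow-step))

  weight-+ : ∀ lo len → weight (λ v → y v + z v) lo len ≡ weight y lo len + weight z lo len
  weight-+ lo zero      = refl
  weight-+ {y} {z} lo (suc len) =
    trans (cong₂ _+_ (*-distribˡ-+ lo (y lo) (z lo)) (weight-+ (suc lo) len))
          (interchange (lo * y lo) (lo * z lo) (weight y (suc lo) len) (weight z (suc lo) len))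

  weight-* : ∀ c lo len → weight (λ v → c * y v) lo len ≡ c * weight y lo len
  weight-* c lo zero      = sym (*-zeroʳ c)
  weight-* {y} c lo (suc len) =
    trans (cong₂ _+_ (x∙yz≈y∙xz lo c (y lo)) (weight-* c (suc lo) len))
          (sym (*-distribˡ-+ c (lo * y lo) (weight y (suc lo) len)))

weight-δ : ∀ x lo len → InWindow lo len x → weight (λ v → δ v x) lo len ≡ x
weight-δ x lo zero      x∈ = ⊥-elim (InWindow-empty x∈)
weight-δ x lo (suc len) x∈ = split (lo ≟ x)
  where
  split : Dec (lo ≡ x) → weight (λ v → δ v x) lo (suc len) ≡ x
  split (yes refl) = trans (cong₂ _+_ (trans (cong (lo *_) (δ-refl lo)) (*-identityʳ lo))
                                      (weight-zero (suc lo) len (λ v v∈ → δ-≢ λ { refl → lo∉InWindow-suc v∈ })))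
                           (+-identityʳ lo)
  split (no lo≢x)  = cong₂ _+_ (trans (cong (lo *_) (δ-≢ lo≢x)) (*-zeroʳ lo))
                               (weight-δ x (suc lo) len (InWindow-above x∈ (lo≢x ∘ sym)))

weight-multiplicity : ∀ lo len xs → All (InWindow lo len) xs →
                      weight (λ v → multiplicity v xs) lo len ≡ sum xs
weight-multiplicity lo len []       []          = weight-zero lo len (λ _ _ → refl)
weight-multiplicity lo len (x ∷ xs) (x∈ ∷ xs∈) =
  trans (weight-+ lo len) (cong₂ _+_ (weight-δ x lo len x∈) (weight-multiplicity lo len xs xs∈))

sum-replicate : ∀ c t → sum (replicate c t) ≡ c * t
sum-replicate zero    t = refl
sum-replicate (suc c) t = cong (t +_) (sum-replicate c t)

∈-replicate : ∀ {x : ℕ} c t → x ∈ replicate c t → x ≡ t × 0 < c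
∈-replicate (suc c) t (here refl) = refl , s≤s z≤n
∈-replicate (suc c) t (there x∈)  = proj₁ (∈-replicate c t x∈) , s≤s z≤n

module _ (y : ℕ → ℕ) where

  sum-expand : ∀ lo len → sum (expand y lo len) ≡ weight y lo len
  sum-expand lo zero      = refl
  sum-expand lo (suc len) = begin
    sum (expand y (suc lo) len ++ replicate (y lo) lo)      ≡⟨ sum-++ (expand y (suc lo) len) _ ⟩
    sum (expand y (suc lo) len) + sum (replicate (y lo) lo) ≡⟨ cong₂ _+_ (sum-expand (suc lo) len) (sum-replicate (y lo) lo) ⟩
    weight y (suc lo) len + y lo * lo                       ≡⟨ +-comm _ (y lo * lo) ⟩
    y lo * lo + weight y (suc lo) len                       ≡⟨ cong (_+ weight y (suc lo) len) (*-comm (y lo) lo) ⟩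
    lo * y lo + weight y (suc lo) len                       ∎
    where open ≡-Reasoning

  ∈-expand : ∀ lo len {x} → x ∈ expand y lo len → InWindow lo len x × 0 < y x
  ∈-expand lo (suc len) x∈ with ∈-++⁻ (expand y (suc lo) len) x∈
  ... | inj₁ x∈above = let (x∈′ , pos) = ∈-expand (suc lo) len x∈above in InWindow-step x∈′ , pos
  ... | inj₂ x∈lo with ∈-replicate (y lo) lo x∈lo
  ...   | refl , pos = InWindow-lo , pos

  multiplicity-expand : ∀ lo len {v} → InWindow lo len v → multiplicity v (expand y lo len) ≡ y v
  multiplicity-expand lo zero      v∈ = ⊥-elim (InWindow-empty v∈)
  multiplicity-expand lo (suc len) {v} v∈ =
    trans (multiplicity-++ v (expand y (suc lo) len) _)
          (trans (cong (multiplicity v (expand y (suc lo) len) +_) (multiplicity-replicate v (y lo) lo)) (split (v ≟ lo)))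
    where
    split : Dec (v ≡ lo) → multiplicity v (expand y (suc lo) len) + y lo * δ v lo ≡ y v
    split (yes refl) = cong₂ _+_ (∉⇒multiplicity≡0 v _ (lo∉InWindow-suc ∘ proj₁ ∘ ∈-expand (suc lo) len))
                                 (trans (cong (y v *_) (δ-refl v)) (*-identityʳ (y v)))
    split (no v≢lo) = trans (cong₂ _+_ (multiplicity-expand (suc lo) len (InWindow-above v∈ v≢lo))
                                       (trans (cong (y lo *_) (δ-≢ v≢lo)) (*-zeroʳ (y lo))))
                            (+-identityʳ (y v))

  Descending-expand : ∀ lo len → Descending (lo + len) (expand y lo len)
  Descending-expand lo zero      = tt
  Descending-expand lo (suc len) =
    Descending-++ (expand y (suc lo) len) _
      (subst (λ m → Descending m (expand y (suc lo) len)) (sym (+-suc lo len)) (Descending-expand (suc lo) len))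
      (All.tabulate (<⇒≤ ∘ proj₁ ∘ proj₁ ∘ ∈-expand (suc lo) len))
      (m≤m+n lo (suc len))
      (Descending-replicate (y lo) lo)
    where
    Descending-++ : ∀ {m t} xs ys → Descending m xs → All (t ≤_) xs → t ≤ m → Descending t ys →
                    Descending m (xs ++ ys)
    Descending-++ []       ys _            _            t≤m dys = Descending-weaken ys t≤m dys
    Descending-++ (x ∷ xs) ys (x≤m , dxs) (t≤x ∷ t≤xs) _   dys = x≤m , Descending-++ xs ys dxs t≤xs t≤x dys
    Descending-replicate : ∀ c t → Descending t (replicate c t)
    Descending-replicate zero    t = tt
    Descending-replicate (suc c) t = ≤-refl , Descending-replicate c t

  smallestPart-expand : ∀ lo len → 0 < y lo → smallestPart (expand y lo (suc len)) ≡ lo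
  smallestPart-expand lo len pos =
    subst (λ c → smallestPart (expand y (suc lo) len ++ replicate c lo) ≡ lo)
          (suc-pred (y lo) {{>-nonZero pos}}) (smallestPart-++-replicate (expand y (suc lo) len) _)
    where
    smallestPart-replicate : ∀ c → smallestPart (replicate (suc c) lo) ≡ lo
    smallestPart-replicate zero    = refl
    smallestPart-replicate (suc c) = smallestPart-replicate c
    smallestPart-++-replicate : ∀ xs c → smallestPart (xs ++ replicate (suc c) lo) ≡ lo
    smallestPart-++-replicate []            c = smallestPart-replicate c
    smallestPart-++-replicate (x ∷ [])      c = smallestPart-replicate c
    smallestPart-++-replicate (x ∷ x′ ∷ xs) c = smallestPart-++-replicate (x′ ∷ xs) c

  expand-∈-partitions : ∀ lo len {n} → 0 < lo → weight y lo len ≡ n → expand y lo len ∈ partitions n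
  expand-∈-partitions lo len 0<lo refl = partitions-complete
    (subst (λ m → Descending m (expand y lo len)) (sum-expand lo len)
           (Descending-head≤sum (expand y lo len) (Descending-expand lo len)))
    (All.tabulate (λ x∈ → ≤-trans 0<lo (proj₁ (proj₁ (∈-expand lo len x∈)))))
    (sum-expand lo len)

divMod-unique : ∀ d .{{_ : NonZero d}} {q₁ r₁ q₂ r₂} → q₁ * d + r₁ ≡ q₂ * d + r₂ →
                r₁ < d → r₂ < d → q₁ ≡ q₂ × r₁ ≡ r₂
divMod-unique d {q₁} {r₁} {q₂} {r₂} eq r₁<d r₂<d = q₁≡q₂ , r₁≡r₂
  where
  open ≡-Reasoning
  r₁≡r₂ : r₁ ≡ r₂
  r₁≡r₂ = begin
    r₁               ≡⟨ sym (m<n⇒m%n≡m r₁<d) ⟩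
    r₁ % d           ≡⟨ sym ([m+kn]%n≡m%n r₁ q₁ d) ⟩
    (r₁ + q₁ * d) % d ≡⟨ cong (_% d) (trans (+-comm r₁ (q₁ * d)) (trans eq (+-comm (q₂ * d) r₂))) ⟩
    (r₂ + q₂ * d) % d ≡⟨ [m+kn]%n≡m%n r₂ q₂ d ⟩
    r₂ % d           ≡⟨ m<n⇒m%n≡m r₂<d ⟩
    r₂               ∎
  q₁≡q₂ : q₁ ≡ q₂
  q₁≡q₂ = *-cancelʳ-≡ q₁ q₂ d (+-cancelʳ-≡ r₁ (q₁ * d) (q₂ * d) (trans eq (cong (q₂ * d +_) (sym r₁≡r₂))))

∸-remainder-cancel : ∀ B .{{_ : NonZero B}} {a₁ a₂ Y₁ Y₂} → Y₁ < B → Y₂ < B →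
                     Y₁ ≤ a₁ * B → Y₂ ≤ a₂ * B → a₁ * B ∸ Y₁ ≡ a₂ * B ∸ Y₂ → a₁ ≡ a₂
∸-remainder-cancel B {a₁} {a₂} {Y₁} {Y₂} Y₁<B Y₂<B Y₁≤ Y₂≤ eq =
  proj₁ (divMod-unique B cross Y₂<B Y₁<B)
  where
  open ≡-Reasoning
  cross : a₁ * B + Y₂ ≡ a₂ * B + Y₁
  cross = begin
    a₁ * B + Y₂                  ≡⟨ cong (_+ Y₂) (sym (m∸n+n≡m Y₁≤)) ⟩
    a₁ * B ∸ Y₁ + Y₁ + Y₂        ≡⟨ cong (λ z → z + Y₁ + Y₂) eq ⟩
    a₂ * B ∸ Y₂ + Y₁ + Y₂        ≡⟨ xy∙z≈xz∙y (a₂ * B ∸ Y₂) Y₁ Y₂ ⟩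
    a₂ * B ∸ Y₂ + Y₂ + Y₁        ≡⟨ cong (_+ Y₁) (m∸n+n≡m Y₂≤) ⟩
    a₂ * B + Y₁                  ∎

mixedRadix-injective : ∀ K {j₁ j₂ m₁ m₂} → 0 < j₁ → j₁ < K → j₂ < K →
                       j₁ * (m₁ * K + 1) ≡ j₂ * (m₂ * K + 1) → j₁ ≡ j₂ × m₁ ≡ m₂
mixedRadix-injective K {j₁} {j₂} {m₁} {m₂} 0<j₁ j₁<K j₂<K eq = j₁≡j₂ , m₁≡m₂
  where
  instance
    K≢0 : NonZero K
    K≢0 = >-nonZero (<-≤-trans 0<j₁ (<⇒≤ j₁<K))
  digits : ∀ j m → j * (m * K + 1) ≡ (j * m) * K + j
  digits j m = distribute j m K
    where
    distribute : ∀ j m K → j * (m * K + 1) ≡ (j * m) * K + j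
    distribute = solve-∀
  split = divMod-unique K (trans (sym (digits j₁ m₁)) (trans eq (digits j₂ m₂))) j₁<K j₂<K
  j₁≡j₂ : j₁ ≡ j₂
  j₁≡j₂ = proj₂ split
  m₁≡m₂ : m₁ ≡ m₂
  m₁≡m₂ = *-cancelˡ-≡ m₁ m₂ j₁ {{>-nonZero 0<j₁}} (trans (proj₁ split) (cong (_* m₂) (sym j₁≡j₂)))

sumUpTo : (ℕ → ℕ) → ℕ → ℕ
sumUpTo f zero    = f 0
sumUpTo f (suc i) = f (suc i) + sumUpTo f i

≤-sumUpTo : ∀ f {i N} → i ≤ N → f i ≤ sumUpTo f N
≤-sumUpTo f {zero}  {zero}  _   = ≤-refl
≤-sumUpTo f {i}     {suc N} i≤N with i ≟ suc N
... | yes refl = m≤m+n (f i) (sumUpTo f N)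
... | no  i≢N  = ≤-trans (≤-sumUpTo f (≤-pred (≤∧≢⇒< i≤N i≢N))) (m≤n+m (sumUpTo f N) (f (suc N)))

twosThrees : ℕ → ℕ × ℕ
twosThrees (suc (suc (suc (suc n)))) = let (β , γ) = twosThrees (suc (suc n)) in suc β , γ
twosThrees 3 = 0 , 1
twosThrees _ = 1 , 0

twosThrees-sum : ∀ n → 2 ≤ n → 2 * proj₁ (twosThrees n) + 3 * proj₂ (twosThrees n) ≡ n
twosThrees-sum 1 (s≤s ())
twosThrees-sum 2 _ = refl
twosThrees-sum 3 _ = refl
twosThrees-sum (suc (suc (suc (suc n)))) _ =
  trans (shift (proj₁ (twosThrees (suc (suc n)))) (proj₂ (twosThrees (suc (suc n)))))
        (cong (2 +_) (twosThrees-sum (suc (suc n)) (s≤s (s≤s z≤n))))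
  where
  shift : ∀ β γ → 2 * suc β + 3 * γ ≡ 2 + (2 * β + 3 * γ)
  shift = solve-∀

-- Gadgets

Allowed : ℕ → ℕ → ℕ → ℕ → Set
Allowed s L k v = s < v × v ≤ s + L × v ≢ k

-- A gadget supplies the allowed parts that replace the copies of the forbidden part k:
-- r copies of block and s·(bulkFill r) copies of filler weigh r·k + s·(r + k·bulkQuot r),
-- m copies of block and s·(borrowFill m) copies of filler weigh m·k + s·(k·borrowQuot m ∸ 1).
record Gadget : Set where
  field
    excess        : ℕ
    block         : List ℕ
    filler        : ℕ
    bulkFill      : ℕ → ℕ
    bulkQuot      : ℕ → ℕ
    bulkQuotBound : ℕ
    borrowFill    : ℕ → ℕ
    borrowQuot    : ℕ → ℕ

record IsGadget (s L k : ℕ) (G : Gadget) : Set where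
  open Gadget G
  field
    block-allowed  : All (Allowed s L k) block
    sum-block      : sum block ≡ k + excess * s
    filler-allowed : Allowed s L k filler
    bulk-balance   : ∀ r → r * excess + bulkFill r * filler ≡ r + k * bulkQuot r
    bulkQuot-bound : ∀ r → r < s → bulkQuot r ≤ bulkQuotBound
    borrow-balance : ∀ m → m * excess + borrowFill m * filler + 1 ≡ k * borrowQuot m

farGadget : ℕ → ℕ → Gadget
farGadget s k = record
  { excess = 1 ; block = suc s ∷ pred k ∷ [] ; filler = pred k
  ; bulkFill = λ _ → 0 ; bulkQuot = λ _ → 0 ; bulkQuotBound = 0
  ; borrowFill = suc ; borrowQuot = suc
  }

farGadget-isGadget : ∀ {s L k} → 1 ≤ L → suc s < k → k ≤ s + L → IsGadget s L k (farGadget s k)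
farGadget-isGadget {s} {L} {suc k} 1≤L s+1<k k≤s+L = record
  { block-allowed  = (≤-refl , subst (_≤ s + L) (+-comm s 1) (+-monoʳ-≤ s 1≤L) , λ e → <-irrefl e s+1<k)
                     ∷ k-allowed ∷ []
  ; sum-block      = sum-block′ s k
  ; filler-allowed = k-allowed
  ; bulk-balance   = λ r → bulk-balance′ r k
  ; bulkQuot-bound = λ _ _ → z≤n
  ; borrow-balance = λ m → borrow-balance′ m k
  }
  where
  k-allowed : Allowed s L (suc k) k
  k-allowed = ≤-pred s+1<k , ≤-trans (n≤1+n k) k≤s+L , 1+n≢n ∘ sym
  sum-block′ : ∀ s k → suc s + (k + 0) ≡ suc k + 1 * s
  sum-block′ = solve-∀
  bulk-balance′ : ∀ r k → r * 1 + 0 * k ≡ r + suc k * 0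
  bulk-balance′ = solve-∀
  borrow-balance′ : ∀ m k → m * 1 + suc m * k + 1 ≡ suc k * suc m
  borrow-balance′ = solve-∀

module NextGadget (s : ℕ) where

  β γ c e e′ : ℕ
  β = proj₁ (twosThrees (suc s))
  γ = proj₂ (twosThrees (suc s))
  c = β + γ
  e = 2 + s ∸ c
  e′ = suc s ∸ c

  gadget : Gadget
  gadget = record
    { excess = c ; block = replicate β (2 + s) ++ replicate γ (3 + s) ; filler = 2 + s
    ; bulkFill = λ r → r * e ; bulkQuot = λ r → r * suc e ; bulkQuotBound = s * suc e
    ; borrowFill = λ m → s + m * e′ ; borrowQuot = λ m → m + suc s + m * e′
    }

  module _ (1≤s : 1 ≤ s) where
    open ≡-Reasoning

    2β+3γ≡1+s : 2 * β + 3 * γ ≡ suc s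
    2β+3γ≡1+s = twosThrees-sum (suc s) (s≤s 1≤s)

    c≤1+s : c ≤ suc s
    c≤1+s = subst (c ≤_) 2β+3γ≡1+s (+-mono-≤ (m≤m+n β (β + 0)) (m≤m+n γ (γ + (γ + 0))))

    sum-block : sum (replicate β (2 + s) ++ replicate γ (3 + s)) ≡ suc s + c * s
    sum-block = begin
      sum (replicate β (2 + s) ++ replicate γ (3 + s))        ≡⟨ sum-++ (replicate β (2 + s)) _ ⟩
      sum (replicate β (2 + s)) + sum (replicate γ (3 + s))   ≡⟨ cong₂ _+_ (sum-replicate β _) (sum-replicate γ _) ⟩
      β * (2 + s) + γ * (3 + s)                               ≡⟨ regroup β γ s ⟩
      (2 * β + 3 * γ) + c * s                                 ≡⟨ cong (_+ c * s) 2β+3γ≡1+s ⟩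
      suc s + c * s                                           ∎
      where
      regroup : ∀ β γ s → β * (2 + s) + γ * (3 + s) ≡ (2 * β + 3 * γ) + (β + γ) * s
      regroup = solve-∀

    bulk-balance : ∀ r → r * c + r * e * (2 + s) ≡ r + suc s * (r * suc e)
    bulk-balance r = begin
      r * c + r * e * (2 + s)         ≡⟨ regroup r c e s ⟩
      r * (c + e) + r * e * suc s     ≡⟨ cong (λ z → r * z + r * e * suc s) (m+[n∸m]≡n (m≤n⇒m≤1+n c≤1+s)) ⟩
      r * (2 + s) + r * e * suc s     ≡⟨ expand′ r e s ⟩
      r + suc s * (r * suc e)         ∎
      where
      regroup : ∀ r c e s → r * c + r * e * (2 + s) ≡ r * (c + e) + r * e * suc s
      regroup = solve-∀
      expand′ : ∀ r e s → r * (2 + s) + r * e * suc s ≡ r + suc s * (r * suc e)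
      expand′ = solve-∀

    borrow-balance : ∀ m → m * c + (s + m * e′) * (2 + s) + 1 ≡ suc s * (m + suc s + m * e′)
    borrow-balance m = begin
      m * c + (s + m * e′) * (2 + s) + 1                 ≡⟨ regroup m c e′ s ⟩
      m * (c + e′) + (s * (2 + s) + 1 + m * e′ * suc s)
        ≡⟨ cong (λ z → m * z + (s * (2 + s) + 1 + m * e′ * suc s)) (m+[n∸m]≡n c≤1+s) ⟩
      m * suc s + (s * (2 + s) + 1 + m * e′ * suc s)     ≡⟨ expand′ m e′ s ⟩
      suc s * (m + suc s + m * e′)                       ∎
      where
      regroup : ∀ m c e′ s → m * c + (s + m * e′) * (2 + s) + 1 ≡ m * (c + e′) + (s * (2 + s) + 1 + m * e′ * suc s)
      regroup = solve-∀
      expand′ : ∀ m e′ s → m * suc s + (s * (2 + s) + 1 + m * e′ * suc s) ≡ suc s * (m + suc s + m * e′)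
      expand′ = solve-∀

  isGadget : ∀ {L} → 1 ≤ s → 3 ≤ L → IsGadget s L (suc s) gadget
  isGadget {L} 1≤s 3≤L = record
    { block-allowed  = All.++⁺ (All.replicate⁺ β two-allowed) (All.replicate⁺ γ three-allowed)
    ; sum-block      = sum-block 1≤s
    ; filler-allowed = two-allowed
    ; bulk-balance   = bulk-balance 1≤s
    ; bulkQuot-bound = λ r r<s → *-monoˡ-≤ (suc e) (<⇒≤ r<s)
    ; borrow-balance = borrow-balance 1≤s
    }
    where
    two-allowed : Allowed s L (suc s) (2 + s)
    two-allowed = m<n+m s (s≤s z≤n) , subst (_≤ s + L) (+-comm s 2) (+-monoʳ-≤ s (≤-trans (n≤1+n 2) 3≤L)) , 1+n≢n
    three-allowed : Allowed s L (suc s) (3 + s)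
    three-allowed = m<n+m s (s≤s z≤n) , subst (_≤ s + L) (+-comm s 3) (+-monoʳ-≤ s 3≤L) ,
                    λ eq → <-irrefl (sym eq) (m<n+m (suc s) {2} (s≤s z≤n))

gadget : ℕ → ℕ → Gadget
gadget s k with k ≟ suc s
... | yes _ = NextGadget.gadget s
... | no  _ = farGadget s k

gadget-isGadget : ∀ {s L k} → 1 ≤ s → 3 ≤ L → s < k → k ≤ s + L → IsGadget s L k (gadget s k)
gadget-isGadget {s} {L} {k} 1≤s 3≤L s<k k≤s+L with k ≟ suc s
... | yes refl = NextGadget.isGadget s 1≤s 3≤L
... | no  k≢   = farGadget-isGadget (≤-trans (s≤s z≤n) 3≤L) (≤∧≢⇒< s<k (k≢ ∘ sym)) k≤s+L

isYes⇒ : ∀ {A : Set} (a? : Dec A) → ⌊ a? ⌋ ≡ true → A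
isYes⇒ (yes a) _  = a
isYes⇒ (no _)  ()

⇒isYes : ∀ {A : Set} (a? : Dec A) → A → ⌊ a? ⌋ ≡ true
⇒isYes (yes _) _ = refl
⇒isYes (no ¬a) a = ⊥-elim (¬a a)

⇒isNo : ∀ {A : Set} (a? : Dec A) → ¬ A → ⌊ a? ⌋ ≡ false
⇒isNo (yes a) ¬a = ⊥-elim (¬a a)
⇒isNo (no _)  _  = refl

allB⇒All : ∀ P xs → allB P xs ≡ true → All (λ x → P x ≡ true) xs
allB⇒All P []       _  = []
allB⇒All P (x ∷ xs) eq = ∧-conicalˡ (P x) _ eq ∷ allB⇒All P xs (∧-conicalʳ (P x) _ eq)

All⇒allB : ∀ P xs → All (λ x → P x ≡ true) xs → allB P xs ≡ true
All⇒allB P []       []          = refl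
All⇒allB P (x ∷ xs) (px ∷ pxs) rewrite px = All⇒allB P xs pxs

All⇒anyB≡false : ∀ P xs → All (λ x → P x ≡ false) xs → anyB P xs ≡ false
All⇒anyB≡false P []       []          = refl
All⇒anyB≡false P (x ∷ xs) (px ∷ pxs) rewrite px = All⇒anyB≡false P xs pxs

isC2Partition : ℕ → ℕ → List ℕ → Bool
isC2Partition L s = allB (λ x → ⌊ suc s ≤? x ⌋ ∧ ⌊ x ≤? s + L ⌋)

isFPartition : ℕ → ℕ → ℕ → List ℕ → Bool
isFPartition L s k π =
  ⌊ smallestPart π ≟ s ⌋ ∧ not (anyB (λ x → ⌊ x ≟ k ⌋) π) ∧ allB (λ x → ⌊ x ≤? L + s ⌋) π

isC2Partition⇒parts : ∀ s L {π} → isC2Partition L s π ≡ true → All (λ v → s < v × v ≤ s + L) π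
isC2Partition⇒parts s L {π} eq = All.map in-range (allB⇒All _ π eq)
  where
  in-range : ∀ {x} → (⌊ suc s ≤? x ⌋ ∧ ⌊ x ≤? s + L ⌋) ≡ true → s < x × x ≤ s + L
  in-range {x} e = isYes⇒ (suc s ≤? x) (∧-conicalˡ _ _ e) , isYes⇒ (x ≤? s + L) (∧-conicalʳ _ _ e)

expand-isFPartition : ∀ s L k (y : ℕ → ℕ) → 0 < y s → y k ≡ 0 →
                      isFPartition L s k (expand y s (suc L)) ≡ true
expand-isFPartition s L k y 0<ys yk≡0 =
  cong₂ _∧_ (⇒isYes (smallestPart (expand y s (suc L)) ≟ s) (smallestPart-expand y s L 0<ys))
    (cong₂ (λ b c → not b ∧ c)
           (All⇒anyB≡false (λ x → ⌊ x ≟ k ⌋) _ (All.tabulate (λ {x} → ⇒isNo (x ≟ k) ∘ ≢k)))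
           (All⇒allB (λ x → ⌊ x ≤? L + s ⌋) _ (All.tabulate (λ {x} → ⇒isYes (x ≤? L + s) ∘ ≤L+s))))
  where
  ≢k : ∀ {x} → x ∈ expand y s (suc L) → x ≢ k
  ≢k x∈ refl = <-irrefl (sym yk≡0) (proj₂ (∈-expand y s (suc L) x∈))
  ≤L+s : ∀ {x} → x ∈ expand y s (suc L) → x ≤ L + s
  ≤L+s {x} x∈ = subst (x ≤_) (+-comm s L)
                  (≤-pred (subst (x <_) (+-suc s L) (proj₂ (proj₁ (∈-expand y s (suc L) x∈)))))

-- The injection

module Thresholds (s L k : ℕ) (G : Gadget) where
  open Gadget G

  kBound : ℕ
  kBound = s + bulkQuotBound * s

  quotBase : ℕ
  quotBase = suc (sumUpTo borrowQuot kBound)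

  code : ℕ → ℕ
  code m = m * suc (s + L) + 1

  -- When m copies of k are replaced and donation m copies of a part j are given up, the
  -- remaining weight is s·(1 + (j·code m·quotBase ∸ borrowQuot m)·k); as borrowQuot m < quotBase
  -- and j < suc (s + L), it determines j and m.
  donation : ℕ → ℕ
  donation m = s * (k * quotBase * code m)

  multiplicityBound : ℕ
  multiplicityBound = donation kBound + kBound

  threshold : ℕ
  threshold = suc (multiplicityBound * weight (λ _ → 1) s (suc L))

module Injection (s L k : ℕ) .{{_ : NonZero s}} (G : Gadget) (isGadget : IsGadget s L k G)
                 (s<k : s < k) (k≤s+L : k ≤ s + L) where
  open Gadget G
  open IsGadget isGadget
  open Thresholds s L k G

  instance
    k≢0 : NonZero k
    k≢0 = >-nonZero (<-trans (>-nonZero⁻¹ s) s<k)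

  Window : ℕ → Set
  Window = InWindow s (suc L)

  ≤s+L⇒Window : ∀ {v} → s ≤ v → v ≤ s + L → Window v
  ≤s+L⇒Window {v} s≤v v≤s+L = s≤v , subst (v <_) (sym (+-suc s L)) (s≤s v≤s+L)

  Window⇒≤s+L : ∀ {v} → Window v → v ≤ s + L
  Window⇒≤s+L {v} (_ , v<) = ≤-pred (subst (v <_) (+-suc s L) v<)

  Allowed⇒Window : ∀ {v} → Allowed s L k v → Window v
  Allowed⇒Window (s<v , v≤s+L , _) = ≤s+L⇒Window (<⇒≤ s<v) v≤s+L

  k∈Window : Window k
  k∈Window = ≤s+L⇒Window (<⇒≤ s<k) k≤s+L

  s≢k : s ≢ k
  s≢k s≡k = <-irrefl s≡k s<k

  Allowed⇒≢s : ∀ {v} → Allowed s L k v → v ≢ s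
  Allowed⇒≢s (s<v , _) refl = <-irrefl refl s<v

  multiplicity-s-block : multiplicity s block ≡ 0
  multiplicity-s-block = ∉⇒multiplicity≡0 s block (λ s∈ → Allowed⇒≢s (All.lookup block-allowed s∈) refl)

  multiplicity-k-block : multiplicity k block ≡ 0
  multiplicity-k-block = ∉⇒multiplicity≡0 k block (λ k∈ → proj₂ (proj₂ (All.lookup block-allowed k∈)) refl)

  record Move : Set where
    constructor mkMove
    field
      sCopies blocks fills donor taken : ℕ
  open Move

  rest : (ℕ → ℕ) → ℕ → ℕ → ℕ → ℕ
  rest x j u v = (1 ∸ δ v k) * (x v ∸ u * δ v j)

  replaced : (ℕ → ℕ) → Move → ℕ → ℕ
  replaced x M v = rest x (donor M) (taken M) v + sCopies M * δ v s
                 + blocks M * multiplicity v block + (s * fills M) * δ v filler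

  replaced-s : ∀ x M → x s ≡ 0 → replaced x M s ≡ sCopies M
  replaced-s x M xs≡0
    rewrite xs≡0 | 0∸n≡0 (taken M * δ s (donor M)) | *-zeroʳ (1 ∸ δ s k) | δ-refl s
          | multiplicity-s-block | δ-≢ (Allowed⇒≢s filler-allowed ∘ sym)
          | *-identityʳ (sCopies M) | *-zeroʳ (blocks M) | *-zeroʳ (s * fills M)
    = trans (+-identityʳ _) (+-identityʳ _)

  replaced-k : ∀ x M → replaced x M k ≡ 0
  replaced-k x M
    rewrite δ-refl k | δ-≢ (s≢k ∘ sym) | multiplicity-k-block | δ-≢ (proj₂ (proj₂ filler-allowed) ∘ sym)
          | *-zeroʳ (sCopies M) | *-zeroʳ (blocks M) | *-zeroʳ (s * fills M)
    = refl

  Donation : (ℕ → ℕ) → ℕ → ℕ → Set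
  Donation x j u = u ≡ 0 ⊎ (Window j × j ≢ k × u ≤ x j)

  module _ {x : ℕ → ℕ} {j u : ℕ} where

    taken≤ : Donation x j u → ∀ v → u * δ v j ≤ x v
    taken≤ (inj₁ refl)           v = z≤n
    taken≤ (inj₂ (_ , _ , u≤xj)) v = split (v ≟ j)
      where
      split : Dec (v ≡ j) → u * δ v j ≤ x v
      split (yes refl) = subst (_≤ x v) (sym (trans (cong (u *_) (δ-refl v)) (*-identityʳ u))) u≤xj
      split (no v≢j)   = subst (_≤ x v) (sym (trans (cong (u *_) (δ-≢ v≢j)) (*-zeroʳ u))) z≤n

    taken-k : Donation x j u → u * δ k j ≡ 0
    taken-k (inj₁ refl)            = refl
    taken-k (inj₂ (_ , j≢k , _))   = trans (cong (u *_) (δ-≢ (j≢k ∘ sym))) (*-zeroʳ u)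

    decompose : Donation x j u → ∀ v → x v ≡ rest x j u v + x k * δ v k + u * δ v j
    decompose don v = split (v ≟ k)
      where
      split : Dec (v ≡ k) → x v ≡ rest x j u v + x k * δ v k + u * δ v j
      split (yes refl) rewrite δ-refl v | taken-k don = sym (trans (+-identityʳ _) (*-identityʳ (x v)))
      split (no v≢k) rewrite δ-≢ v≢k | *-zeroʳ (x k) | *-identityˡ (x v ∸ u * δ v j)
                           | +-identityʳ (x v ∸ u * δ v j) = sym (m∸n+n≡m (taken≤ don v))

  weight-decompose : ∀ {x j u} → Donation x j u →
                     weight x s (suc L) ≡ weight (rest x j u) s (suc L) + x k * k + u * j
  weight-decompose {x} {j} {u} don = begin
    weight x s (suc L)
      ≡⟨ weight-cong s (suc L) (λ v _ → decompose don v) ⟩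
    weight (λ v → rest x j u v + x k * δ v k + u * δ v j) s (suc L)
      ≡⟨ weight-+ s (suc L) ⟩
    weight (λ v → rest x j u v + x k * δ v k) s (suc L) + weight (λ v → u * δ v j) s (suc L)
      ≡⟨ cong₂ _+_ (trans (weight-+ s (suc L)) (cong (weight (rest x j u) s (suc L) +_) kept)) (donated don) ⟩
    weight (rest x j u) s (suc L) + x k * k + u * j
      ∎
    where
    open ≡-Reasoning
    kept : weight (λ v → x k * δ v k) s (suc L) ≡ x k * k
    kept = trans (weight-* (x k) s (suc L)) (cong (x k *_) (weight-δ k s (suc L) k∈Window))
    donated : Donation x j u → weight (λ v → u * δ v j) s (suc L) ≡ u * j
    donated (inj₁ refl)     = weight-zero s (suc L) (λ _ _ → refl)
    donated (inj₂ (j∈ , _)) = trans (weight-* u s (suc L)) (cong (u *_) (weight-δ j s (suc L) j∈))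

  weight-replaced : ∀ x M → weight (replaced x M) s (suc L) ≡
    weight (rest x (donor M) (taken M)) s (suc L) + sCopies M * s + blocks M * sum block + (s * fills M) * filler
  weight-replaced x M =
    trans (weight-+ s (suc L))
      (cong₂ _+_
        (trans (weight-+ s (suc L))
          (cong₂ _+_
            (trans (weight-+ s (suc L))
              (cong (weight (rest x (donor M) (taken M)) s (suc L) +_)
                (trans (weight-* (sCopies M) s (suc L)) (cong (sCopies M *_) (weight-δ s s (suc L) InWindow-lo)))))
            (trans (weight-* (blocks M) s (suc L))
              (cong (blocks M *_) (weight-multiplicity s (suc L) block (All.map Allowed⇒Window block-allowed))))))
        (trans (weight-* (s * fills M) s (suc L))
          (cong ((s * fills M) *_) (weight-δ filler s (suc L) (Allowed⇒Window filler-allowed)))))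

  kCount kQuot kRem : List ℕ → ℕ
  kCount l = multiplicity k l
  kQuot l = kCount l / s
  kRem l = kCount l % s

  Bulk : List ℕ → Set
  Bulk l = bulkQuot (kRem l) < kQuot l

  Donor : List ℕ → ℕ → Set
  Donor l j = s < j × j ≢ k × donation (kCount l) ≤ multiplicity j l

  donor? : ∀ l j → Dec (Donor l j)
  donor? l j = (s <? j) ×-dec ¬? (j ≟ k) ×-dec (donation (kCount l) ≤? multiplicity j l)

  data Case (l : List ℕ) : Set where
    bulk   : Bulk l → Case l
    borrow : ¬ Bulk l → ∀ j → j ≤ s + L → Donor l j → Case l
    stuck  : ¬ Bulk l → (∀ j → j ≤ s + L → ¬ Donor l j) → Case l

  case : ∀ l → Case l
  case l with bulkQuot (kRem l) <? kQuot l
  ... | yes b = bulk b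
  ... | no ¬b with anyUpTo? (donor? l) (suc (s + L))
  ...   | yes (j , j<  , d) = borrow ¬b j (≤-pred j<) d
  ...   | no  ¬d            = stuck ¬b (λ j j≤ d → ¬d (j , s≤s j≤ , d))

  -- The number of copies of s encodes the case and its parameters.
  -- The stuck case does not occur for n ≥ threshold, so any move will do there.
  move : ∀ l → Case l → Move
  move l (bulk _) = mkMove (suc ((kQuot l ∸ suc (bulkQuot (kRem l))) * k + (k ∸ suc (kRem l))))
                           (kRem l) (bulkFill (kRem l)) s 0
  move l (borrow _ j _ _) = mkMove (suc ((j * code (kCount l) * quotBase ∸ borrowQuot (kCount l)) * k))
                                   (kCount l) (borrowFill (kCount l)) j (donation (kCount l))
  move l (stuck _ _) = mkMove 1 0 0 s 0

  occ : List ℕ → ℕ → ℕ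
  occ l v = multiplicity v l

  image : List ℕ → List ℕ
  image l = expand (replaced (occ l) (move l (case l))) s (suc L)

  record Source (n : ℕ) (l : List ℕ) : Set where
    field
      descending : Descending n l
      parts      : All (λ v → s < v × v ≤ s + L) l
      sum≡n      : sum l ≡ n

  source : ∀ {n l} → l ∈ partitions n → isC2Partition L s l ≡ true → Source n l
  source l∈ c2l = let (ds , _ , sum≡n) = partitions-sound l∈ in record
    { descending = ds ; parts = isC2Partition⇒parts s L c2l ; sum≡n = sum≡n }

  module _ {n l} (src : Source n l) where
    open Source src

    source-Window : All Window l
    source-Window = All.map (λ (s<v , v≤s+L) → ≤s+L⇒Window (<⇒≤ s<v) v≤s+L) parts

    source-occ-s : occ l s ≡ 0
    source-occ-s = ∉⇒multiplicity≡0 s l (λ s∈ → <-irrefl refl (proj₁ (All.lookup parts s∈)))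

    source-occ-outside : ∀ v → ¬ Window v → occ l v ≡ 0
    source-occ-outside v v∉ = ∉⇒multiplicity≡0 v l (v∉ ∘ All.lookup source-Window)

    source-weight : weight (occ l) s (suc L) ≡ n
    source-weight = trans (weight-multiplicity s (suc L) l source-Window) sum≡n

  kCount≡ : ∀ l → kCount l ≡ kRem l + kQuot l * s
  kCount≡ l = m≡m%n+[m/n]*n (kCount l) s

  kRem<s : ∀ l → kRem l < s
  kRem<s l = m%n<n (kCount l) s

  ¬Bulk⇒kCount≤kBound : ∀ l → ¬ Bulk l → kCount l ≤ kBound
  ¬Bulk⇒kCount≤kBound l ¬b = subst (_≤ kBound) (sym (kCount≡ l))
    (+-mono-≤ (<⇒≤ (kRem<s l)) (*-monoˡ-≤ s (≤-trans (≮⇒≥ ¬b) (bulkQuot-bound (kRem l) (kRem<s l)))))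

  donation-mono : ∀ {m m′} → m ≤ m′ → donation m ≤ donation m′
  donation-mono m≤m′ = *-monoʳ-≤ s (*-monoʳ-≤ (k * quotBase) (+-monoˡ-≤ 1 (*-monoˡ-≤ (suc (s + L)) m≤m′)))

  borrowQuot<quotBase : ∀ {m} → m ≤ kBound → borrowQuot m < quotBase
  borrowQuot<quotBase m≤ = s≤s (≤-sumUpTo borrowQuot m≤)

  borrowQuot≤ : ∀ {j m} → 0 < j → m ≤ kBound → borrowQuot m ≤ j * code m * quotBase
  borrowQuot≤ {j} {m} 0<j m≤ = ≤-trans (<⇒≤ (borrowQuot<quotBase m≤))
    (m≤n*m quotBase (j * code m) {{>-nonZero (*-mono-≤ 0<j (m≤n+m 1 (m * suc (s + L))))}})

  stuck-impossible : ∀ {n l} → Source n l → threshold ≤ n → ¬ Bulk l → (∀ j → j ≤ s + L → ¬ Donor l j) → ⊥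
  stuck-impossible {n} {l} src t≤n ¬b ¬donor = <-irrefl refl (<-≤-trans n<threshold t≤n)
    where
    bounded : ∀ v → Window v → occ l v ≤ multiplicityBound * 1
    bounded v v∈ = subst (occ l v ≤_) (sym (*-identityʳ multiplicityBound)) (split (v ≟ s) (v ≟ k))
      where
      split : Dec (v ≡ s) → Dec (v ≡ k) → occ l v ≤ multiplicityBound
      split (yes refl) _          = subst (_≤ multiplicityBound) (sym (source-occ-s src)) z≤n
      split (no _)     (yes refl) = ≤-trans (¬Bulk⇒kCount≤kBound l ¬b) (m≤n+m kBound (donation kBound))
      split (no v≢s)   (no v≢k)   = ≤-trans (<⇒≤ (≰⇒> not-donor))
                                      (≤-trans (donation-mono (¬Bulk⇒kCount≤kBound l ¬b)) (m≤m+n (donation kBound) kBound))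
        where
        not-donor : ¬ donation (kCount l) ≤ occ l v
        not-donor d≤ = ¬donor v (Window⇒≤s+L v∈) (≤∧≢⇒< (proj₁ v∈) (v≢s ∘ sym) , v≢k , d≤)
    n<threshold : n < threshold
    n<threshold = s≤s (begin
      n                                                  ≡⟨ sym (source-weight src) ⟩
      weight (occ l) s (suc L)                           ≤⟨ weight-mono s (suc L) bounded ⟩
      weight (λ _ → multiplicityBound * 1) s (suc L)     ≡⟨ weight-* multiplicityBound s (suc L) ⟩
      multiplicityBound * weight (λ _ → 1) s (suc L)     ∎)
      where open ≤-Reasoning

  Balanced : List ℕ → Move → Set
  Balanced l M = sCopies M * s + blocks M * sum block + (s * fills M) * filler ≡ kCount l * k + taken M * donor M

  bulk-balanced : ∀ l (b : Bulk l) → Balanced l (move l (bulk b))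
  bulk-balanced l b = begin
    suc (Z * k + ρ) * s + r * sum block + (s * bulkFill r) * filler
      ≡⟨ cong (λ σ → suc (Z * k + ρ) * s + r * σ + (s * bulkFill r) * filler) sum-block ⟩
    suc (Z * k + ρ) * s + r * (k + excess * s) + (s * bulkFill r) * filler
      ≡⟨ regroup Z k ρ s r excess (bulkFill r) filler ⟩
    s * (1 + Z * k + ρ) + r * k + s * (r * excess + bulkFill r * filler)
      ≡⟨ cong (λ z → s * (1 + Z * k + ρ) + r * k + s * z) (bulk-balance r) ⟩
    s * (1 + Z * k + ρ) + r * k + s * (r + k * bulkQuot r)
      ≡⟨ regroup′ s Z k ρ r (bulkQuot r) ⟩
    s * (Z * k + (ρ + suc r)) + r * k + s * k * bulkQuot r
      ≡⟨ cong (λ z → s * (Z * k + z) + r * k + s * k * bulkQuot r) (m∸n+n≡m (<-trans (kRem<s l) s<k)) ⟩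
    s * (Z * k + k) + r * k + s * k * bulkQuot r
      ≡⟨ regroup″ s Z k r (bulkQuot r) ⟩
    (r + (Z + suc (bulkQuot r)) * s) * k + 0 * s
      ≡⟨ cong (λ z → (r + z * s) * k + 0 * s) (m∸n+n≡m b) ⟩
    (r + kQuot l * s) * k + 0 * s
      ≡⟨ cong (λ z → z * k + 0 * s) (sym (kCount≡ l)) ⟩
    kCount l * k + 0 * s
      ∎
    where
    open ≡-Reasoning
    r = kRem l
    Z = kQuot l ∸ suc (bulkQuot r)
    ρ = k ∸ suc r
    regroup : ∀ Z k ρ s r c f p → suc (Z * k + ρ) * s + r * (k + c * s) + (s * f) * p ≡
                                  s * (1 + Z * k + ρ) + r * k + s * (r * c + f * p)
    regroup = solve-∀
    regroup′ : ∀ s Z k ρ r q → s * (1 + Z * k + ρ) + r * k + s * (r + k * q) ≡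
                               s * (Z * k + (ρ + suc r)) + r * k + s * k * q
    regroup′ = solve-∀
    regroup″ : ∀ s Z k r q → s * (Z * k + k) + r * k + s * k * q ≡ (r + (Z + suc q) * s) * k + 0 * s
    regroup″ = solve-∀

  borrow-balanced : ∀ l ¬b j j≤ (d : Donor l j) → Balanced l (move l (borrow ¬b j j≤ d))
  borrow-balanced l ¬b j _ (s<j , _) = begin
    suc (Z * k) * s + m * sum block + (s * borrowFill m) * filler
      ≡⟨ cong (λ σ → suc (Z * k) * s + m * σ + (s * borrowFill m) * filler) sum-block ⟩
    suc (Z * k) * s + m * (k + excess * s) + (s * borrowFill m) * filler
      ≡⟨ regroup Z k s m excess (borrowFill m) filler ⟩
    m * k + s * (m * excess + borrowFill m * filler + 1) + s * Z * k
      ≡⟨ cong (λ z → m * k + s * z + s * Z * k) (borrow-balance m) ⟩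
    m * k + s * (k * borrowQuot m) + s * Z * k
      ≡⟨ regroup′ m k s (borrowQuot m) Z ⟩
    m * k + s * k * (Z + borrowQuot m)
      ≡⟨ cong (λ z → m * k + s * k * z) (m∸n+n≡m (borrowQuot≤ 0<j (¬Bulk⇒kCount≤kBound l ¬b))) ⟩
    m * k + s * k * (j * code m * quotBase)
      ≡⟨ regroup″ m k s quotBase j (code m) ⟩
    m * k + donation m * j
      ∎
    where
    open ≡-Reasoning
    m = kCount l
    Z = j * code m * quotBase ∸ borrowQuot m
    0<j = <-≤-trans (s≤s z≤n) s<j
    regroup : ∀ Z k s m c f p → suc (Z * k) * s + m * (k + c * s) + (s * f) * p ≡
                                m * k + s * (m * c + f * p + 1) + s * Z * k
    regroup = solve-∀
    regroup′ : ∀ m k s Y Z → m * k + s * (k * Y) + s * Z * k ≡ m * k + s * k * (Z + Y)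
    regroup′ = solve-∀
    regroup″ : ∀ m k s B j x → m * k + s * k * (j * x * B) ≡ m * k + s * (k * B * x) * j
    regroup″ = solve-∀

  moveDonation : ∀ l (c : Case l) → Donation (occ l) (donor (move l c)) (taken (move l c))
  moveDonation l (bulk _)                          = inj₁ refl
  moveDonation l (borrow _ j j≤ (s<j , j≢k , d≤)) = inj₂ (≤s+L⇒Window (<⇒≤ s<j) j≤ , j≢k , d≤)
  moveDonation l (stuck _ _)                       = inj₁ refl

  case-balanced : ∀ {n l} → Source n l → threshold ≤ n → (c : Case l) → Balanced l (move l c)
  case-balanced {l = l} _   _   (bulk b)             = bulk-balanced l b
  case-balanced {l = l} _   _   (borrow ¬b j j≤ d)   = borrow-balanced l ¬b j j≤ d
  case-balanced         src t≤n (stuck ¬b ¬d)        = ⊥-elim (stuck-impossible src t≤n ¬b ¬d)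

  sCopies>0 : ∀ l (c : Case l) → 0 < sCopies (move l c)
  sCopies>0 l (bulk _)         = s≤s z≤n
  sCopies>0 l (borrow _ _ _ _) = s≤s z≤n
  sCopies>0 l (stuck _ _)      = s≤s z≤n

  image-weight : ∀ {n l} → Source n l → threshold ≤ n → weight (replaced (occ l) (move l (case l))) s (suc L) ≡ n
  image-weight {n} {l} src t≤n = begin
    weight (replaced (occ l) M) s (suc L)                       ≡⟨ weight-replaced (occ l) M ⟩
    R + sCopies M * s + blocks M * sum block + (s * fills M) * filler ≡⟨ regroup R _ _ _ ⟩
    R + (sCopies M * s + blocks M * sum block + (s * fills M) * filler) ≡⟨ cong (R +_) (case-balanced src t≤n (case l)) ⟩
    R + (kCount l * k + taken M * donor M)                      ≡⟨ sym (+-assoc R _ _) ⟩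
    R + kCount l * k + taken M * donor M                        ≡⟨ sym (weight-decompose (moveDonation l (case l))) ⟩
    weight (occ l) s (suc L)                                    ≡⟨ source-weight src ⟩
    n                                                           ∎
    where
    open ≡-Reasoning
    M = move l (case l)
    R = weight (rest (occ l) (donor M) (taken M)) s (suc L)
    regroup : ∀ R a b c → R + a + b + c ≡ R + (a + b + c)
    regroup = solve-∀

  image-∈ : ∀ {n l} → Source n l → threshold ≤ n → image l ∈ partitions n × isFPartition L s k (image l) ≡ true
  image-∈ {l = l} src t≤n =
    expand-∈-partitions _ s (suc L) (>-nonZero⁻¹ s) (image-weight src t≤n) ,
    expand-isFPartition s L k _
      (subst (0 <_) (sym (replaced-s (occ l) M (source-occ-s src))) (sCopies>0 l (case l)))
                     (replaced-k (occ l) M)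
    where M = move l (case l)

  recover : ∀ {x₁ x₂ M} → Donation x₁ (donor M) (taken M) → Donation x₂ (donor M) (taken M) → x₁ k ≡ x₂ k →
            (∀ v → Window v → replaced x₁ M v ≡ replaced x₂ M v) → ∀ v → Window v → x₁ v ≡ x₂ v
  recover {x₁} {x₂} {M} don₁ don₂ x₁k≡x₂k replaced≡ v v∈ = begin
    x₁ v                                                   ≡⟨ decompose don₁ v ⟩
    rest x₁ j u v + x₁ k * δ v k + u * δ v j
      ≡⟨ cong₂ (λ a b → a + b * δ v k + u * δ v j) rest≡ x₁k≡x₂k ⟩
    rest x₂ j u v + x₂ k * δ v k + u * δ v j               ≡⟨ sym (decompose don₂ v) ⟩
    x₂ v                                                   ∎
    where
    open ≡-Reasoning
    j = donor M
    u = taken M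
    rest≡ : rest x₁ j u v ≡ rest x₂ j u v
    rest≡ = +-cancelʳ-≡ _ _ _ (+-cancelʳ-≡ _ _ _ (+-cancelʳ-≡ _ _ _ (replaced≡ v v∈)))

  k∸1+r<k : ∀ l → k ∸ suc (kRem l) < k
  k∸1+r<k l = ∸-monoʳ-< (s≤s z≤n) (<-trans (kRem<s l) s<k)

  bulk≢borrow : ∀ {l₁ l₂} (b : Bulk l₁) ¬b j j≤ (d : Donor l₂ j) →
                sCopies (move l₁ (bulk b)) ≢ sCopies (move l₂ (borrow ¬b j j≤ d))
  bulk≢borrow {l₁} {l₂} b ¬b j j≤ d eq = <-irrefl (sym ρ≡0) (m<n⇒0<n∸m (≤-<-trans (kRem<s l₁) s<k))
    where
    Z₂ = j * code (kCount l₂) * quotBase ∸ borrowQuot (kCount l₂)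
    ρ≡0 : k ∸ suc (kRem l₁) ≡ 0
    ρ≡0 = proj₂ (divMod-unique k {kQuot l₁ ∸ suc (bulkQuot (kRem l₁))} {k ∸ suc (kRem l₁)} {Z₂}
                   (trans (suc-injective eq) (sym (+-identityʳ (Z₂ * k)))) (k∸1+r<k l₁) (>-nonZero⁻¹ k))

  decode-bulk : ∀ {l₁ l₂} (b₁ : Bulk l₁) (b₂ : Bulk l₂) →
                sCopies (move l₁ (bulk b₁)) ≡ sCopies (move l₂ (bulk b₂)) →
                move l₁ (bulk b₁) ≡ move l₂ (bulk b₂) × kCount l₁ ≡ kCount l₂
  decode-bulk {l₁} {l₂} b₁ b₂ eq = cong₂ bulkMove t≡ r≡ , kCount≡′
    where
    bulkMove : ℕ → ℕ → Move
    bulkMove t r = mkMove (suc ((t ∸ suc (bulkQuot r)) * k + (k ∸ suc r))) r (bulkFill r) s 0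
    digits = divMod-unique k {kQuot l₁ ∸ suc (bulkQuot (kRem l₁))} {k ∸ suc (kRem l₁)}
                             {kQuot l₂ ∸ suc (bulkQuot (kRem l₂))} {k ∸ suc (kRem l₂)}
                             (suc-injective eq) (k∸1+r<k l₁) (k∸1+r<k l₂)
    r≡ : kRem l₁ ≡ kRem l₂
    r≡ = suc-injective (∸-cancelˡ-≡ (<-trans (kRem<s l₁) s<k) (<-trans (kRem<s l₂) s<k) (proj₂ digits))
    t≡ : kQuot l₁ ≡ kQuot l₂
    t≡ = trans (sym (m∸n+n≡m b₁)) (trans (cong₂ _+_ (proj₁ digits) (cong (suc ∘ bulkQuot) r≡)) (m∸n+n≡m b₂))
    kCount≡′ : kCount l₁ ≡ kCount l₂
    kCount≡′ = trans (kCount≡ l₁) (trans (cong₂ (λ r t → r + t * s) r≡ t≡) (sym (kCount≡ l₂)))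

  decode-borrow : ∀ {l₁ l₂} ¬b₁ j₁ j₁≤ (d₁ : Donor l₁ j₁) ¬b₂ j₂ j₂≤ (d₂ : Donor l₂ j₂) →
                  sCopies (move l₁ (borrow ¬b₁ j₁ j₁≤ d₁)) ≡ sCopies (move l₂ (borrow ¬b₂ j₂ j₂≤ d₂)) →
                  move l₁ (borrow ¬b₁ j₁ j₁≤ d₁) ≡ move l₂ (borrow ¬b₂ j₂ j₂≤ d₂) × kCount l₁ ≡ kCount l₂
  decode-borrow {l₁} {l₂} ¬b₁ j₁ j₁≤ (s<j₁ , _) ¬b₂ j₂ j₂≤ (s<j₂ , _) eq = cong₂ borrowMove j≡ m≡ , m≡
    where
    borrowMove : ℕ → ℕ → Move
    borrowMove j m = mkMove (suc ((j * code m * quotBase ∸ borrowQuot m) * k)) m (borrowFill m) j (donation m)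
    m₁≤ = ¬Bulk⇒kCount≤kBound l₁ ¬b₁
    m₂≤ = ¬Bulk⇒kCount≤kBound l₂ ¬b₂
    0<j₁ = <-≤-trans (s≤s z≤n) s<j₁
    0<j₂ = <-≤-trans (s≤s z≤n) s<j₂
    codes≡ : j₁ * code (kCount l₁) ≡ j₂ * code (kCount l₂)
    codes≡ = ∸-remainder-cancel quotBase (borrowQuot<quotBase m₁≤) (borrowQuot<quotBase m₂≤)
               (borrowQuot≤ 0<j₁ m₁≤) (borrowQuot≤ 0<j₂ m₂≤) (*-cancelʳ-≡ _ _ k (suc-injective eq))
    digits = mixedRadix-injective (suc (s + L)) 0<j₁ (s≤s j₁≤) (s≤s j₂≤) codes≡
    j≡ = proj₁ digits
    m≡ = proj₂ digits

  decode : ∀ {n l₁ l₂} → Source n l₁ → Source n l₂ → threshold ≤ n → (c₁ : Case l₁) (c₂ : Case l₂) →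
           sCopies (move l₁ c₁) ≡ sCopies (move l₂ c₂) → move l₁ c₁ ≡ move l₂ c₂ × kCount l₁ ≡ kCount l₂
  decode src₁ _    t≤n (stuck ¬b ¬d)        _                    _  = ⊥-elim (stuck-impossible src₁ t≤n ¬b ¬d)
  decode _    src₂ t≤n (bulk _)             (stuck ¬b ¬d)        _  = ⊥-elim (stuck-impossible src₂ t≤n ¬b ¬d)
  decode _    src₂ t≤n (borrow _ _ _ _)     (stuck ¬b ¬d)        _  = ⊥-elim (stuck-impossible src₂ t≤n ¬b ¬d)
  decode {l₁ = l₁} {l₂} _ _ _ (bulk b₁) (bulk b₂) eq = decode-bulk {l₁} {l₂} b₁ b₂ eq
  decode {l₁ = l₁} {l₂} _ _ _ (bulk b) (borrow ¬b j j≤ d) eq = ⊥-elim (bulk≢borrow {l₁} {l₂} b ¬b j j≤ d eq)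
  decode {l₁ = l₁} {l₂} _ _ _ (borrow ¬b j j≤ d) (bulk b) eq = ⊥-elim (bulk≢borrow {l₂} {l₁} b ¬b j j≤ d (sym eq))
  decode {l₁ = l₁} {l₂} _ _ _ (borrow ¬b₁ j₁ j₁≤ d₁) (borrow ¬b₂ j₂ j₂≤ d₂) eq =
    decode-borrow {l₁} {l₂} ¬b₁ j₁ j₁≤ d₁ ¬b₂ j₂ j₂≤ d₂ eq

  image-injective : ∀ {n l₁ l₂} → Source n l₁ → Source n l₂ → threshold ≤ n →
                    image l₁ ≡ image l₂ → l₁ ≡ l₂
  image-injective {n} {l₁} {l₂} src₁ src₂ t≤n eq =
    Descending-≡ l₁ l₂ (Source.descending src₁) (Source.descending src₂) multiplicity≡
    where
    M₁ = move l₁ (case l₁)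
    M₂ = move l₂ (case l₂)
    replaced≡ : ∀ v → Window v → replaced (occ l₁) M₁ v ≡ replaced (occ l₂) M₂ v
    replaced≡ v v∈ = trans (sym (multiplicity-expand _ s (suc L) v∈))
                           (trans (cong (multiplicity v) eq) (multiplicity-expand _ s (suc L) v∈))
    decoded = decode src₁ src₂ t≤n (case l₁) (case l₂)
                (trans (sym (replaced-s (occ l₁) M₁ (source-occ-s src₁)))
                  (trans (replaced≡ s InWindow-lo) (replaced-s (occ l₂) M₂ (source-occ-s src₂))))
    M₁≡M₂ = proj₁ decoded
    occ≡ : ∀ v → Window v → occ l₁ v ≡ occ l₂ v
    occ≡ = recover {M = M₁} (moveDonation l₁ (case l₁))
             (subst (λ M → Donation (occ l₂) (donor M) (taken M)) (sym M₁≡M₂) (moveDonation l₂ (case l₂)))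
             (proj₂ decoded)
             (λ v v∈ → trans (replaced≡ v v∈) (cong (λ M → replaced (occ l₂) M v) (sym M₁≡M₂)))
    multiplicity≡ : ∀ v → multiplicity v l₁ ≡ multiplicity v l₂
    multiplicity≡ v with InWindow? s (suc L) v
    ... | yes v∈ = occ≡ v v∈
    ... | no  v∉ = trans (source-occ-outside src₁ v v∉) (sym (source-occ-outside src₂ v v∉))

  c2≤f : ∀ n → threshold ≤ n → c2 L s n ≤ f L s k n
  c2≤f n t≤n = count-mono-injection (isC2Partition L s) (isFPartition L s k) n image
    (λ l∈ c2l → image-∈ (source l∈ c2l) t≤n)
    (λ l₁∈ c2l₁ l₂∈ c2l₂ → image-injective (source l₁∈ c2l₁) (source l₂∈ c2l₂) t≤n)

theorem2p1 : (L s : ℕ) → 1 ≤ s → 3 ≤ L →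
    ∃ λ M → (k n : ℕ) → (suc s ⊔ L) ≤ k → k ≤ s + L → M ≤ n →
      c2 L s n ≤ f L s k n
theorem2p1 L s 1≤s 3≤L = sumUpTo thresholdFor (s + L) , λ k n s⊔L≤k k≤s+L M≤n →
  let s<k = ≤-trans (m≤m⊔n (suc s) L) s⊔L≤k in
  Injection.c2≤f s L k (gadget s k) (gadget-isGadget 1≤s 3≤L s<k k≤s+L) s<k k≤s+L n
    (≤-trans (≤-sumUpTo thresholdFor k≤s+L) M≤n)
  where
  instance
    s≢0 : NonZero s
    s≢0 = >-nonZero 1≤s
  thresholdFor : ℕ → ℕ
  thresholdFor k = Thresholds.threshold s L k (gadget s k)
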